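{- Let $m\geq 1$ and $k\geq 1$ be integers, and let $n_0,\ldots,n_{k-1}$ and $t_0,\ldots,t_{k-1}$ be nonnegative integers. Then there exist nonnegative integers $n$ and $t$ such that for every $1\leq \ell\leq m$, \[s_2(n+\ell t)-s_2(n+(\ell-1)t)=\sum_{0\leq j<k}\bigl(s_2(n_j+\ell t_j)-s_2(n_j+(\ell-1)t_j)\bigr).\]
   Context: For a nonnegative integer $n$ with binary expansion $n=\varepsilon_\nu 2^\nu+\cdots+\varepsilon_0 2^0$ ($\varepsilon_i\in\{0,1\}$), the binary sum-of-digits function is $s_2(n)=\varepsilon_\nu+\cdots+\varepsilon_0$, i.e. the number of nonzero binary digits of $n$. -}

module Defs where

open import Data.Nat using (ℕ; zero; suc; _+_; _*_; _%_; _/_; _∸_)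
open import Data.Integer using (ℤ; +_; _-_)
import Data.Integer as ℤ
import Data.Fin as F
open F using (Fin)

-- Binary digit sum, computed with fuel: go f n for f ≥ n is s₂(n).
s₂-go : ℕ → ℕ → ℕ
s₂-go zero    n = 0
s₂-go (suc f) n = n % 2 + s₂-go f (n / 2)

s₂ : ℕ → ℕ
s₂ n = s₂-go n n

-- D(a, b, ℓ) = s₂(a + ℓ b) − s₂(a + (ℓ−1) b), as an integer, for ℓ ≥ 1
-- (ℓ ∸ 1 is truncated subtraction, exact since ℓ ≥ 1 where used)
Δ : ℕ → ℕ → ℕ → ℤ
Δ a b ℓ = + s₂ (a + ℓ * b) - + s₂ (a + (ℓ ∸ 1) * b)

Σℤ : (k : ℕ) → (Fin k → ℤ) → ℤ
Σℤ zero    f = + 0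
Σℤ (suc k) f = f F.zero ℤ.+ Σℤ k (λ j → f (F.suc j))

module Submission where

-- Idea: binary concatenation.  If a < 2^E then the binary expansion of
-- a + 2^E·b is that of b followed by the E digits of a, so
--   s₂(a + 2^E·b) = s₂(a) + s₂(b).
-- Given (n₀,t₀) and a pair (n',t') that already realises the sum over the
-- remaining indices, choose E with n₀ + m·t₀ < 2^E and put
--   n = n₀ + 2^E·n',   t = t₀ + 2^E·t'.
-- For every 0 ≤ l ≤ m we have n + l·t = (n₀ + l·t₀) + 2^E·(n' + l·t') with
-- n₀ + l·t₀ < 2^E, so the digit sums, hence the differences Δ, add up.

open import Defs
open import Data.Nat using (ℕ; suc; _≤_; _<_; _+_; _*_)
open import Data.Integer using (ℤ)
open import Data.Fin using (Fin)
open import Data.Product using (Σ; _×_)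
open import Relation.Binary.PropositionalEquality using (_≡_)

open import Data.Nat using (zero; _%_; _/_; _^_; _∸_; z≤n; s≤s)
open import Data.Nat.Properties
open import Data.Nat.DivMod
open import Data.Nat.Divisibility using (divides-refl)
open import Data.Product using (_,_)
open import Relation.Binary.PropositionalEquality
  using (refl; cong; cong₂; sym; trans; module ≡-Reasoning)
import Data.Integer as ℤ
import Data.Nat.Tactic.RingSolver as ℕ-Solver
import Data.Integer.Tactic.RingSolver as ℤ-Solver
import Data.Fin as F

s₂-go-zero : ∀ f → s₂-go f 0 ≡ 0
s₂-go-zero zero    = refl
s₂-go-zero (suc f) = s₂-go-zero f

half-≤ : ∀ n f → n ≤ suc f → n / 2 ≤ f
half-≤ zero    f _         = z≤n
half-≤ (suc n) f (s≤s n≤f) =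
  ≤-trans (≤-pred (m/n<m (suc n) 2 (s≤s (s≤s z≤n)))) n≤f

s₂-go-fuel : ∀ f g n → n ≤ f → n ≤ g → s₂-go f n ≡ s₂-go g n
s₂-go-fuel zero    g       zero _ _ = sym (s₂-go-zero g)
s₂-go-fuel (suc f) zero    zero _ _ = s₂-go-zero (suc f)
s₂-go-fuel (suc f) (suc g) n    p q =
  cong (n % 2 +_) (s₂-go-fuel f g (n / 2) (half-≤ n f p) (half-≤ n g q))

s₂-unfold : ∀ x → s₂ x ≡ x % 2 + s₂ (x / 2)
s₂-unfold zero    = refl
s₂-unfold (suc x) =
  cong (suc x % 2 +_)
       (s₂-go-fuel x (suc x / 2) (suc x / 2) (half-≤ (suc x) x ≤-refl) ≤-refl)

s₂-concat : ∀ E a b → a < 2 ^ E → s₂ (a + 2 ^ E * b) ≡ s₂ a + s₂ b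
s₂-concat zero    zero    b _          = cong s₂ (+-identityʳ b)
s₂-concat zero    (suc a) b (s≤s ())
s₂-concat (suc E) a       b a<2^[1+E] = begin
    s₂ (a + 2 ^ suc E * b)
  ≡⟨ cong (λ z → s₂ (a + z)) shift ⟩
    s₂ (a + c * 2)
  ≡⟨ s₂-unfold (a + c * 2) ⟩
    (a + c * 2) % 2 + s₂ ((a + c * 2) / 2)
  ≡⟨ cong₂ (λ u v → u + s₂ v) ([m+kn]%n≡m%n a c 2) halve ⟩
    a % 2 + s₂ (a / 2 + 2 ^ E * b)
  ≡⟨ cong (a % 2 +_) (s₂-concat E (a / 2) b (m<n*o⇒m/o<n a<2^E*2)) ⟩
    a % 2 + (s₂ (a / 2) + s₂ b)
  ≡⟨ sym (+-assoc (a % 2) _ _) ⟩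
    (a % 2 + s₂ (a / 2)) + s₂ b
  ≡⟨ cong (_+ s₂ b) (sym (s₂-unfold a)) ⟩
    s₂ a + s₂ b ∎
  where
  open ≡-Reasoning
  c = 2 ^ E * b
  shift : 2 ^ suc E * b ≡ c * 2
  shift = trans (*-assoc 2 (2 ^ E) b) (*-comm 2 c)
  halve : (a + c * 2) / 2 ≡ a / 2 + c
  halve = trans (+-distrib-/-∣ʳ a (divides-refl c)) (cong (a / 2 +_) (m*n/n≡m c 2))
  a<2^E*2 : a < 2 ^ E * 2
  a<2^E*2 = ≤-trans a<2^[1+E] (≤-reflexive (*-comm 2 (2 ^ E)))

n<2^n : ∀ n → n < 2 ^ n
n<2^n zero    = s≤s z≤n
n<2^n (suc n) = begin-strict
  suc n          ≡⟨ +-comm 1 n ⟩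
  n + 1          <⟨ +-mono-<-≤ (n<2^n n) (m^n>0 2 n) ⟩
  2 ^ n + 2 ^ n  ≡⟨ cong (2 ^ n +_) (sym (+-identityʳ (2 ^ n))) ⟩
  2 ^ suc n      ∎
  where open ≤-Reasoning

progression-concat : ∀ a b n t c l →
  (a + c * n) + l * (b + c * t) ≡ (a + l * b) + c * (n + l * t)
progression-concat = ℕ-Solver.solve-∀

sub-interchange : ∀ (A B C D : ℤ) →
  (A ℤ.+ B) ℤ.- (C ℤ.+ D) ≡ (A ℤ.- C) ℤ.+ (B ℤ.- D)
sub-interchange = ℤ-Solver.solve-∀

Δ-concat : ∀ m E a b n t → a + m * b < 2 ^ E → ∀ ℓ → ℓ ≤ m →
  Δ (a + 2 ^ E * n) (b + 2 ^ E * t) ℓ ≡ Δ a b ℓ ℤ.+ Δ n t ℓ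
Δ-concat m E a b n t bound ℓ ℓ≤m = begin
    ℤ.+ s₂ (N + ℓ * T) ℤ.- ℤ.+ s₂ (N + (ℓ ∸ 1) * T)
  ≡⟨ cong₂ (λ u v → ℤ.+ u ℤ.- ℤ.+ v) (s₂-split ℓ ℓ≤m) (s₂-split (ℓ ∸ 1) ℓ-1≤m) ⟩
    (ℤ.+ s₂ (a + ℓ * b) ℤ.+ ℤ.+ s₂ (n + ℓ * t))
      ℤ.- (ℤ.+ s₂ (a + (ℓ ∸ 1) * b) ℤ.+ ℤ.+ s₂ (n + (ℓ ∸ 1) * t))
  ≡⟨ sub-interchange (ℤ.+ s₂ (a + ℓ * b)) (ℤ.+ s₂ (n + ℓ * t))
                     (ℤ.+ s₂ (a + (ℓ ∸ 1) * b)) (ℤ.+ s₂ (n + (ℓ ∸ 1) * t)) ⟩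
    Δ a b ℓ ℤ.+ Δ n t ℓ ∎
  where
  open ≡-Reasoning
  N = a + 2 ^ E * n
  T = b + 2 ^ E * t
  ℓ-1≤m : ℓ ∸ 1 ≤ m
  ℓ-1≤m = ≤-trans (m∸n≤m ℓ 1) ℓ≤m
  fits : ∀ l → l ≤ m → a + l * b < 2 ^ E
  fits l l≤m = ≤-<-trans (+-monoʳ-≤ a (*-monoˡ-≤ b l≤m)) bound
  s₂-split : ∀ l → l ≤ m → s₂ (N + l * T) ≡ s₂ (a + l * b) + s₂ (n + l * t)
  s₂-split l l≤m = trans (cong s₂ (progression-concat a b n t (2 ^ E) l))
                         (s₂-concat E _ _ (fits l l≤m))

Δ-zero : ∀ ℓ → Δ 0 0 ℓ ≡ ℤ.+ 0
Δ-zero ℓ rewrite *-zeroʳ ℓ | *-zeroʳ (ℓ ∸ 1) = refl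

realise : (m k : ℕ) → (ns ts : Fin k → ℕ) →
  Σ ℕ (λ n → Σ ℕ (λ t → (ℓ : ℕ) → 1 ≤ ℓ → ℓ ≤ m →
    Δ n t ℓ ≡ Σℤ k (λ j → Δ (ns j) (ts j) ℓ)))
realise m zero    ns ts = 0 , 0 , λ ℓ _ _ → Δ-zero ℓ
realise m (suc k) ns ts
  with realise m k (λ j → ns (F.suc j)) (λ j → ts (F.suc j))
... | n' , t' , tail = n₀ + 2 ^ E * n' , t₀ + 2 ^ E * t' , λ ℓ 1≤ℓ ℓ≤m →
  trans (Δ-concat m E n₀ t₀ n' t' (n<2^n E) ℓ ℓ≤m)
        (cong (λ z → Δ n₀ t₀ ℓ ℤ.+ z) (tail ℓ 1≤ℓ ℓ≤m))
  where
  n₀ = ns F.zero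
  t₀ = ts F.zero
  E  = n₀ + m * t₀

lemma1 : (m k : ℕ) → 1 ≤ m → 1 ≤ k → (ns ts : Fin k → ℕ) →
    Σ ℕ (λ n → Σ ℕ (λ t → (ℓ : ℕ) → 1 ≤ ℓ → ℓ ≤ m →
      Δ n t ℓ ≡ Σℤ k (λ j → Δ (ns j) (ts j) ℓ)))
lemma1 m k _ _ ns ts = realise m k ns ts
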